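{- Realizability of existential HyperLTL specifications is decidable: there is an algorithm that, given $\mathrm{AP} = I \mathbin{\dot\cup} O$ and a HyperLTL formula $\varphi = \exists \pi_1 \cdots \exists \pi_n.\ \psi$ over $\mathrm{AP}$ ($\psi$ quantifier-free), decides whether $\varphi$ is realizable.
   Context: HyperLTL formulas over $\mathrm{AP}$ are built as $\varphi ::= \exists \pi.\varphi \mid \forall \pi.\varphi \mid \psi$ and $\psi ::= a_\pi \mid \neg\psi \mid \psi\lor\psi \mid \mathsf{X}\psi \mid \psi\,\mathsf{U}\,\psi$ with $a \in \mathrm{AP}$ and trace variables $\pi$. A set of traces $T \subseteq (2^{\mathrm{AP}})^\omega$ satisfies a formula under the standard semantics where quantifiers range over traces in $T$. A strategy is a function $f\colon (2^I)^+ \to 2^O$; the set of traces generated by $f$ consists of all traces $w$ with $w_i \cap O = f((w_0\cap I)\cdots(w_i\cap I))$ for all $i\ge 0$. $\varphi$ is realizable if there is a strategy whose set of generated traces satisfies $\varphi$. -}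

module Defs where

open import Data.Nat using (ℕ; zero; suc; _≤_; _<_)
open import Data.Fin using (Fin; toℕ)
open import Data.Fin.Subset using (Subset)
open import Data.Vec using (Vec; lookup; tabulate)
open import Data.Vec.Functional using (_∷_)
open import Data.Bool using (Bool; true)
open import Data.Sum using (_⊎_; inj₁; inj₂)
open import Data.Product using (Σ; _×_; proj₁; proj₂)
open import Data.Empty using (⊥)
open import Relation.Binary.PropositionalEquality using (_≡_)

module _ (ni no : ℕ) where

  AP : Set
  AP = Fin ni ⊎ Fin no

  -- A letter of 2^AP, written literally as a pair (w ∩ I , w ∩ O) of subsets.
  Letter : Set
  Letter = Subset ni × Subset no

  Trace : Set
  Trace = ℕ → Letter

  _∈L_ : AP → Letter → Set
  inj₁ x ∈L ℓ = lookup (proj₁ ℓ) x ≡ true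
  inj₂ y ∈L ℓ = lookup (proj₂ ℓ) y ≡ true

  -- Quantifier-free HyperLTL bodies over n trace variables (de Bruijn: Fin n).
  data QF (n : ℕ) : Set where
    atom : AP → Fin n → QF n
    ¬'_  : QF n → QF n
    _∨'_ : QF n → QF n → QF n
    X'   : QF n → QF n
    _U'_ : QF n → QF n → QF n

  data Hyper : ℕ → Set where
    ∃'   : ∀ {n} → Hyper (suc n) → Hyper n
    ∀'   : ∀ {n} → Hyper (suc n) → Hyper n
    body : ∀ {n} → QF n → Hyper n

  ⟦_⟧ : ∀ {n} → QF n → (Fin n → Trace) → ℕ → Set
  ⟦ atom a π ⟧ Π i = a ∈L (Π π i)
  ⟦ ¬' ψ ⟧ Π i = ⟦ ψ ⟧ Π i → ⊥
  ⟦ ψ ∨' χ ⟧ Π i = ⟦ ψ ⟧ Π i ⊎ ⟦ χ ⟧ Π i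
  ⟦ X' ψ ⟧ Π i = ⟦ ψ ⟧ Π (suc i)
  ⟦ ψ U' χ ⟧ Π i =
    Σ ℕ λ k → i ≤ k × ⟦ χ ⟧ Π k × (∀ j → i ≤ j → j < k → ⟦ ψ ⟧ Π j)

  Sat : (Trace → Set) → ∀ {n} → (Fin n → Trace) → Hyper n → Set
  Sat T Π (∃' φ) = Σ Trace λ t → T t × Sat T (t ∷ Π) φ
  Sat T Π (∀' φ) = (t : Trace) → T t → Sat T (t ∷ Π) φ
  Sat T Π (body ψ) = ⟦ ψ ⟧ Π 0

  -- Strategies f : (2^I)^+ → 2^O ; a nonempty word of length suc m is a Vec.
  Strategy : Set
  Strategy = (m : ℕ) → Vec (Subset ni) (suc m) → Subset no

  Generated : Strategy → Trace → Set
  Generated f w = ∀ i → proj₂ (w i) ≡ f i (tabulate λ (j : Fin (suc i)) → proj₁ (w (toℕ j)))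

  Realizable : Hyper 0 → Set
  Realizable φ = Σ Strategy λ f → Sat (Generated f) (λ ()) φ

  data Existential : ∀ {n} → Hyper n → Set where
    body : ∀ {n} (ψ : QF n) → Existential (body ψ)
    ∃'   : ∀ {n} {φ : Hyper (suc n)} → Existential φ → Existential (∃' φ)

module Submission where

-- A strategy f generates exactly the traces whose outputs are f applied to
-- their input histories.  Hence ∃π₁ ⋯ ∃πₖ. ψ is realizable iff there are k
-- traces satisfying ψ that are consistent: traces with equal input histories
-- up to i have equal outputs at i (from such traces one reads off a strategy,
-- and the traces generated by any strategy are consistent).  Consistency of k
-- traces is expressible in LTL over the alphabet of k-tuples of letters, so
-- realizability reduces to satisfiability of one LTL formula over a finite
-- alphabet.
--
-- LTL satisfiability is decided by a search for ultimately periodic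
-- Hintikka sequences (lassos) among finitely many candidates.  Labels record
-- guessed truth values of next- and until-subformulas; along a locally
-- consistent labelling whose pending until-obligations are all eventually
-- discharged every guess is correct (truth lemma), which makes a valid lasso
-- a model.  Conversely, classically correct labels exist along any model; by
-- pigeonhole two of K + 1 positions, separated by windows that discharge all
-- obligations, carry the same state and close a valid lasso, and loop erasure
-- shortens the lasso below a bound.  Since candidates are finite and validity
-- is decidable, the classical (double-negated) completeness argument suffices
-- for a constructive decision procedure.

open import Defs
open import Data.Bool using (Bool; true; false; not; _∧_; _∨_; T)
open import Data.Bool.Properties using (T-∨; T-∧; T?; T-≡)
import Data.Bool.Properties as Bool
open import Data.Empty using (⊥-elim)
open import Data.Fin using (Fin; toℕ; fromℕ<)
import Data.Fin as Fin
open import Data.Fin.Properties using (pigeonhole; toℕ<n; toℕ-fromℕ<)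
import Data.Fin.Properties as Fin
open import Data.Fin.Subset using (Subset)
open import Data.List using (List; []; _∷_; _++_; [_]; map; length; lookup; cartesianProduct; allFin)
open import Data.List.Membership.Propositional using (_∈_; _∉_; find; lose)
open import Data.List.Membership.Propositional.Properties
  using (∈-map⁺; ∈-++⁺ˡ; ∈-++⁺ʳ; ∈-++⁻; ∈-cartesianProduct⁺; ∈-∃++; ∈-allFin)
open import Data.List.Relation.Binary.Subset.Propositional using (_⊆_)
open import Data.List.Relation.Binary.Subset.Propositional.Properties using (Any-resp-⊆)
import Data.List.Relation.Unary.All as All
import Data.List.Relation.Unary.All.Properties as All
open import Data.List.Relation.Unary.Any using (Any; here; there)
import Data.List.Relation.Unary.Any as Any
open import Data.List.Relation.Unary.Any.Properties using (lookup-index)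
open import Data.List.Properties using (length-++)
open import Data.Nat using (ℕ; zero; suc; _+_; _*_; _∸_; _≤_; _<_; _⊔_; z≤n; s≤s; _<?_)
open import Data.Nat.Properties hiding (_≟_)
open import Data.Product using (Σ; Σ-syntax; _×_; _,_; proj₁; proj₂; uncurry)
import Data.Product.Properties as Product
open import Data.Sum using (_⊎_; inj₁; inj₂; [_,_]′)
open import Data.Unit using (⊤; tt)
open import Data.Vec using (Vec; []; _∷_)
import Data.Vec as Vec
import Data.Vec.Properties as Vec
import Data.Vec.Functional as Functional
open import Effect.Monad using (RawMonad)
open import Function using (_∘_; _⇔_; mk⇔; Equivalence)
import Function.Properties.Equivalence as ⇔
open import Level using (0ℓ)
open import Relation.Binary.Definitions using (DecidableEquality)
open import Relation.Binary.PropositionalEquality using (_≡_; _≢_; refl; sym; trans; cong; subst; subst₂; module ≡-Reasoning)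
open import Relation.Nullary using (Dec; yes; no; ¬_; does; proof)
open import Relation.Nullary.Decidable.Core using (¬¬-excluded-middle)
open import Relation.Nullary.Decidable using (map′; _×-dec_; _→-dec_; isYes; toWitness; fromWitness)
import Relation.Nullary.Decidable as Dec
open import Data.Sum.Function.Propositional using (_⊎-⇔_)
open import Relation.Nullary.Reflects using (Reflects; ofʸ; ofⁿ; fromEquivalence; det; T-reflects; ¬-reflects; _×-reflects_; _⊎-reflects_)
open import Relation.Nullary.Negation using (¬¬-Monad; independence-of-premise)

record Finite (A : Set) : Set where
  field
    elements : List A
    complete : ∀ x → x ∈ elements
    _≟_      : DecidableEquality A

open Finite

finite-⊤ : Finite ⊤
finite-⊤ = record { elements = [ tt ] ; complete = λ _ → here refl ; _≟_ = λ _ _ → yes refl }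

finite-Bool : Finite Bool
finite-Bool = record
  { elements = true ∷ false ∷ []
  ; complete = λ { true → here refl ; false → there (here refl) }
  ; _≟_      = Bool._≟_
  }

finite-× : ∀ {A B : Set} → Finite A → Finite B → Finite (A × B)
finite-× FA FB = record
  { elements = cartesianProduct (elements FA) (elements FB)
  ; complete = λ (a , b) → ∈-cartesianProduct⁺ (complete FA a) (complete FB b)
  ; _≟_      = Product.≡-dec (_≟_ FA) (_≟_ FB)
  }

boundedLists : ∀ {A : Set} → List A → ℕ → List (List A)
boundedLists xs zero    = [ [] ]
boundedLists xs (suc k) = [] ∷ map (uncurry _∷_) (cartesianProduct xs (boundedLists xs k))

∈-boundedLists : ∀ {A : Set} (FA : Finite A) k (l : List A) → length l ≤ k → l ∈ boundedLists (elements FA) k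
∈-boundedLists FA zero    []      _         = here refl
∈-boundedLists FA (suc k) []      _         = here refl
∈-boundedLists FA (suc k) (x ∷ l) (s≤s l≤k) =
  there (∈-map⁺ (uncurry _∷_) (∈-cartesianProduct⁺ (complete FA x) (∈-boundedLists FA k l l≤k)))

vectors : ∀ {A : Set} → List A → (n : ℕ) → List (Vec A n)
vectors xs zero    = [ [] ]
vectors xs (suc n) = map (uncurry _∷_) (cartesianProduct xs (vectors xs n))

finite-Vec : ∀ {A : Set} → Finite A → ∀ n → Finite (Vec A n)
finite-Vec {A} FA n = record { elements = vectors (elements FA) n ; complete = complete-vectors ; _≟_ = Vec.≡-dec (_≟_ FA) }
  where
  complete-vectors : ∀ {n} (v : Vec A n) → v ∈ vectors (elements FA) n
  complete-vectors []      = here refl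
  complete-vectors (x ∷ v) = ∈-map⁺ (uncurry _∷_) (∈-cartesianProduct⁺ (complete FA x) (complete-vectors v))

∀-dec : ∀ {A : Set} {P : A → Set} (xs : List A) → (∀ x → x ∈ xs) → (∀ x → Dec (P x)) → Dec (∀ x → P x)
∀-dec xs complete-xs P? =
  map′ (λ all x → All.lookup all (complete-xs x)) (λ f → All.tabulate (λ {x} _ → f x)) (All.all? P? xs)

pigeonhole-finite : ∀ {B : Set} (FB : Finite B) (f : ℕ → B)
  → Σ[ a ∈ ℕ ] Σ[ b ∈ ℕ ] a < b × b ≤ length (elements FB) × f a ≡ f b
pigeonhole-finite FB f with pigeonhole (n<1+n _) (λ i → Any.index (complete FB (f (toℕ i))))
... | i , j , i<j , same = toℕ i , toℕ j , i<j , ≤-pred (toℕ<n j) ,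
      trans (lookup-index (complete FB _)) (trans (cong (lookup (elements FB)) same) (sym (lookup-index (complete FB _))))

module _ {B : Set} where

  NoDup : List B → Set
  NoDup []       = ⊤
  NoDup (x ∷ xs) = x ∉ xs × NoDup xs

  NoDup-suffix : ∀ l₁ {l₂ : List B} → NoDup (l₁ ++ l₂) → NoDup l₂
  NoDup-suffix []       nd       = nd
  NoDup-suffix (_ ∷ l₁) (_ , nd) = NoDup-suffix l₁ nd

  remove : ∀ {x : B} ys → x ∈ ys → List B
  remove (_ ∷ ys) (here _)  = ys
  remove (y ∷ ys) (there p) = y ∷ remove ys p

  remove-length : ∀ {x : B} ys (p : x ∈ ys) → suc (length (remove ys p)) ≡ length ys
  remove-length (_ ∷ ys) (here _)  = refl
  remove-length (_ ∷ ys) (there p) = cong suc (remove-length ys p)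

  remove-∈ : ∀ {x z : B} ys (p : x ∈ ys) → z ∈ ys → z ≢ x → z ∈ remove ys p
  remove-∈ (_ ∷ ys) (here refl) (here refl)  z≢x = ⊥-elim (z≢x refl)
  remove-∈ (_ ∷ ys) (here refl) (there z∈ys) _   = z∈ys
  remove-∈ (_ ∷ ys) (there p)   (here refl)  _   = here refl
  remove-∈ (_ ∷ ys) (there p)   (there z∈ys) z≢x = there (remove-∈ ys p z∈ys z≢x)

  NoDup-length : ∀ xs (ys : List B) → NoDup xs → xs ⊆ ys → length xs ≤ length ys
  NoDup-length []       ys _            _   = z≤n
  NoDup-length (x ∷ xs) ys (x∉xs , nd) sub =
    subst (suc (length xs) ≤_) (remove-length ys x∈ys)
      (s≤s (NoDup-length xs (remove ys x∈ys) nd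
             (λ z∈xs → remove-∈ ys x∈ys (sub (there z∈xs)) (λ { refl → x∉xs z∈xs }))))
    where
    x∈ys : x ∈ ys
    x∈ys = sub (here refl)

witnesses : ∀ {X B : Set} {P : X → B → Set} → (∀ x b → Dec (P x b)) → (xs : List X) (L : List B)
  → Σ[ W ∈ List B ] length W ≤ length xs × W ⊆ L × (∀ {x} → x ∈ xs → Any (P x) L → Any (P x) W)
witnesses P? []       L = [] , z≤n , (λ ()) , λ ()
witnesses P? (x ∷ xs) L with witnesses P? xs L | Any.any? (P? x) L
... | W , len , W⊆L , hit | no ¬px =
  W , m≤n⇒m≤1+n len , W⊆L , λ { (here refl) px → ⊥-elim (¬px px) ; (there x∈xs) → hit x∈xs }
... | W , len , W⊆L , hit | yes px with find px
...   | b , b∈L , pb =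
  b ∷ W , s≤s len , (λ { (here refl) → b∈L ; (there q) → W⊆L q }) ,
  λ { (here refl) _ → here pb ; (there x∈xs) h → there (hit x∈xs h) }

-- Classical reasoning is confined to the double-negation monad.
open RawMonad (¬¬-Monad {0ℓ}) using (pure; _>>=_)

infix 1 ¬¬_
¬¬_ : Set → Set
¬¬ A = ¬ ¬ A

¬¬-common-bound : ∀ {X : Set} {P : X → ℕ → Set} → (∀ x {m m′} → m ≤ m′ → P x m → P x m′)
  → (∀ x → ¬¬ Σ ℕ (P x)) → (xs : List X) (m₀ : ℕ) → ¬¬ Σ[ m ∈ ℕ ] m₀ ≤ m × (∀ x → x ∈ xs → P x m)
¬¬-common-bound mono bound []       m₀ = pure (m₀ , ≤-refl , λ _ ())
¬¬-common-bound mono bound (x ∷ xs) m₀ =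
  bound x >>= λ (m , px) → ¬¬-common-bound mono bound xs m₀ >>= λ (m′ , m₀≤m′ , pxs) →
  pure (m ⊔ m′ , ≤-trans m₀≤m′ (m≤n⊔m m m′) , λ
    { y (here refl) → mono y (m≤m⊔n m m′) px
    ; y (there y∈xs) → mono y (m≤n⊔m m m′) (pxs y y∈xs) })

extend : ∀ {X : Set} → (ℕ → X) → ℕ → X → ℕ → X
extend f n x i with i <? n
... | yes _ = f i
... | no  _ = x

extend-< : ∀ {X : Set} (f : ℕ → X) {n} x {i} → i < n → extend f n x i ≡ f i
extend-< f {n} x {i} i<n with i <? n
... | yes _  = refl
... | no i≮n = ⊥-elim (i≮n i<n)

extend-≡ : ∀ {X : Set} (f : ℕ → X) n x → extend f n x n ≡ x
extend-≡ f n x with n <? n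
... | yes n<n = ⊥-elim (<-irrefl refl n<n)
... | no _    = refl

¬¬-choice : ∀ {X : Set} {P : ℕ → X → Set} → (∀ q → ¬¬ Σ X (P q))
  → ∀ M → ¬¬ Σ[ f ∈ (ℕ → X) ] (∀ q → q ≤ M → P q (f q))
¬¬-choice witness zero =
  witness 0 >>= λ (x , p) → pure ((λ _ → x) , λ { zero _ → p })
¬¬-choice {P = P} witness (suc M) =
  ¬¬-choice witness M >>= λ (f , ps) → witness (suc M) >>= λ (x , p) →
  pure (extend f (suc M) x , λ q q≤1+M → extended q q≤1+M ps p)
  where
  extended : ∀ {f x} q → q ≤ suc M → (∀ q → q ≤ M → P q (f q)) → P (suc M) x → P q (extend f (suc M) x q)
  extended {f} {x} q q≤1+M ps p with m≤n⇒m<n∨m≡n q≤1+M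
  ... | inj₁ q<1+M = subst (P q) (sym (extend-< f x q<1+M)) (ps q (≤-pred q<1+M))
  ... | inj₂ refl  = subst (P q) (sym (extend-≡ f q x)) p

¬¬-chain : ∀ {X : Set} {R : X → X → Set} → (∀ x → ¬¬ Σ X (R x)) → ∀ x₀ T
  → ¬¬ Σ[ f ∈ (ℕ → X) ] f 0 ≡ x₀ × (∀ i → i < T → R (f i) (f (suc i)))
¬¬-chain next x₀ zero = pure ((λ _ → x₀) , refl , λ _ ())
¬¬-chain {R = R} next x₀ (suc T) =
  ¬¬-chain next x₀ T >>= λ (f , f0 , steps) → next (f T) >>= λ (y , r) →
  pure (extend f (suc T) y , trans (extend-< f {suc T} y (s≤s z≤n)) f0 , extended f steps y r)
  where
  extended : ∀ f → (∀ i → i < T → R (f i) (f (suc i))) → ∀ y → R (f T) y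
    → ∀ i → i < suc T → R (extend f (suc T) y i) (extend f (suc T) y (suc i))
  extended f steps y r i i<1+T with m≤n⇒m<n∨m≡n (≤-pred i<1+T)
  ... | inj₁ i<T = subst₂ R (sym (extend-< f y i<1+T)) (sym (extend-< f y (s≤s i<T))) (steps i i<T)
  ... | inj₂ refl = subst₂ R (sym (extend-< f y (n<1+n i))) (sym (extend-≡ f (suc i) y)) r

module _ {B : Set} (R : B → B → Set) where

  Path : B → List B → B → Set
  Path x []      y = R x y
  Path x (z ∷ l) y = R x z × Path z l y

  path-split : ∀ x l₁ z l₂ y → Path x (l₁ ++ z ∷ l₂) y → Path x l₁ z × Path z l₂ y
  path-split x []       z l₂ y (r , p) = r , p
  path-split x (v ∷ l₁) z l₂ y (r , p) = let (p₁ , p₂) = path-split v l₁ z l₂ y p in (r , p₁) , p₂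

  path-join : ∀ x l₁ z l₂ y → Path x l₁ z → Path z l₂ y → Path x (l₁ ++ z ∷ l₂) y
  path-join x []       z l₂ y r        p₂ = r , p₂
  path-join x (v ∷ l₁) z l₂ y (r , p₁) p₂ = r , path-join v l₁ z l₂ y p₁ p₂

  path? : (∀ x y → Dec (R x y)) → ∀ x l y → Dec (Path x l y)
  path? R? x []      y = R? x y
  path? R? x (z ∷ l) y = R? x z ×-dec path? R? z l y

window : ∀ {B : Set} → (ℕ → B) → ℕ → ℕ → List B
window s i zero    = []
window s i (suc n) = s i ∷ window s (suc i) n

module _ {B : Set} (s : ℕ → B) where

  ∈-window⁺ : ∀ {i j} n → i ≤ j → j < i + n → s j ∈ window s i n
  ∈-window⁺ {i} {j} zero    i≤j j<i+0 = ⊥-elim (<-irrefl refl (≤-<-trans i≤j (subst (j <_) (+-identityʳ i) j<i+0)))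
  ∈-window⁺ {i} {j} (suc n) i≤j j<i+n with m≤n⇒m<n∨m≡n i≤j
  ... | inj₂ refl = here refl
  ... | inj₁ i<j  = there (∈-window⁺ n i<j (subst (j <_) (+-suc i n) j<i+n))

  ∈-window⁻ : ∀ {x} i n → x ∈ window s i n → Σ[ j ∈ ℕ ] i ≤ j × j < i + n × x ≡ s j
  ∈-window⁻ i (suc n) (here refl) = i , ≤-refl , m<m+n i (s≤s z≤n) , refl
  ∈-window⁻ i (suc n) (there x∈) with ∈-window⁻ (suc i) n x∈
  ... | j , i<j , j< , e = j , <⇒≤ i<j , subst (j <_) (sym (+-suc i n)) j< , e

  path-window : ∀ (R : B → B → Set) i n → (∀ j → j < i + suc n → R (s j) (s (suc j)))
    → Path R (s i) (window s (suc i) n) (s (i + suc n))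
  path-window R i zero    steps = subst (R (s i) ∘ s) (sym (+-comm i 1)) (steps i (subst (i <_) (+-comm 1 i) ≤-refl))
  path-window R i (suc n) steps =
    steps i (m<m+n i (s≤s z≤n)) ,
    subst (Path R (s (suc i)) (window s (suc (suc i)) n) ∘ s) (sym (+-suc i (suc n)))
      (path-window R (suc i) n (λ j j< → steps j (subst (j <_) (sym (+-suc i (suc n))) j<)))

monotone-upto : ∀ (f : ℕ → ℕ) T → (∀ i → i < T → f i ≤ f (suc i)) → ∀ {i j} → i ≤ j → j ≤ T → f i ≤ f j
monotone-upto f T inc {i} {zero}  z≤n _ = ≤-refl
monotone-upto f T inc {i} {suc j} i≤1+j 1+j≤T with m≤n⇒m<n∨m≡n i≤1+j
... | inj₂ refl   = ≤-refl
... | inj₁ i<1+j  = ≤-trans (monotone-upto f T inc (≤-pred i<1+j) (<⇒≤ 1+j≤T)) (inc j 1+j≤T)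

module Shortening {B : Set} (FB : Finite B) (R : B → B → Set) where

  K : ℕ
  K = length (elements FB)

  erase : ∀ x l y → Path R x l y → Σ[ l′ ∈ List B ] Path R x l′ y × l′ ⊆ l × NoDup l′
  erase x []      y r = [] , r , (λ ()) , tt
  erase x (z ∷ l) y (r , p) with erase z l y p
  ... | l′ , p′ , l′⊆l , nd with Any.any? (_≟_ FB z) l′
  ... | no z∉l′ = z ∷ l′ , (r , p′) , (λ { (here refl) → here refl ; (there q) → there (l′⊆l q) }) , z∉l′ , nd
  ... | yes z∈l′ with ∈-∃++ z∈l′
  ... | l₁ , l₂ , refl =
    z ∷ l₂ , (r , proj₂ (path-split R z l₁ z l₂ y p′)) ,
    (λ { (here refl) → here refl ; (there q) → there (l′⊆l (∈-++⁺ʳ l₁ (there q))) }) , NoDup-suffix l₁ nd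

  -- Length bound for paths keeping n required points: each required point
  -- splits the path into two shorter ones.
  bound : ℕ → ℕ
  bound zero    = K
  bound (suc n) = suc (bound n + bound n)

  bound-mono : ∀ {m n} → m ≤ n → bound m ≤ bound n
  bound-mono {zero}  {zero}  _         = ≤-refl
  bound-mono {zero}  {suc n} _         = ≤-trans (bound-mono {zero} {n} z≤n) (≤-trans (m≤m+n _ _) (n≤1+n _))
  bound-mono {suc m} {suc n} (s≤s m≤n) = s≤s (+-mono-≤ (bound-mono m≤n) (bound-mono m≤n))

  shorten : ∀ (req : List B) x l y → Path R x l y
    → Σ[ l′ ∈ List B ] Path R x l′ y × l′ ⊆ l × (∀ {r} → r ∈ req → r ∈ l → r ∈ l′)
                       × length l′ ≤ bound (length req)
  shorten [] x l y p with erase x l y p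
  ... | l′ , p′ , l′⊆l , nd =
    l′ , p′ , l′⊆l , (λ ()) , NoDup-length l′ (elements FB) nd (λ {z} _ → complete FB z)
  shorten (r ∷ req) x l y p with Any.any? (_≟_ FB r) l
  ... | no r∉l with shorten req x l y p
  ...   | l′ , p′ , l′⊆l , keep , len =
    l′ , p′ , l′⊆l , (λ { (here refl) r∈l → ⊥-elim (r∉l r∈l) ; (there q) → keep q }) ,
    ≤-trans len (≤-trans (m≤m+n _ _) (n≤1+n _))
  shorten (r ∷ req) x l y p | yes r∈l with ∈-∃++ r∈l
  ... | l₁ , l₂ , refl with path-split R x l₁ r l₂ y p
  ...   | p₁ , p₂ with shorten req x l₁ r p₁ | shorten req r l₂ y p₂
  ...     | l₁′ , p₁′ , sub₁ , keep₁ , len₁ | l₂′ , p₂′ , sub₂ , keep₂ , len₂ =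
    l₁′ ++ r ∷ l₂′ , path-join R x l₁′ r l₂′ y p₁′ p₂′ , sub , keep , len
    where
    sub : l₁′ ++ r ∷ l₂′ ⊆ l₁ ++ r ∷ l₂
    sub q with ∈-++⁻ l₁′ q
    ... | inj₁ q₁         = ∈-++⁺ˡ (sub₁ q₁)
    ... | inj₂ (here e)   = ∈-++⁺ʳ l₁ (here e)
    ... | inj₂ (there q₂) = ∈-++⁺ʳ l₁ (there (sub₂ q₂))
    keep : ∀ {v} → v ∈ r ∷ req → v ∈ l₁ ++ r ∷ l₂ → v ∈ l₁′ ++ r ∷ l₂′
    keep (here refl) _ = ∈-++⁺ʳ l₁′ (here refl)
    keep (there v∈req) q with ∈-++⁻ l₁ q
    ... | inj₁ q₁         = ∈-++⁺ˡ (keep₁ v∈req q₁)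
    ... | inj₂ (here e)   = ∈-++⁺ʳ l₁′ (here e)
    ... | inj₂ (there q₂) = ∈-++⁺ʳ l₁′ (there (keep₂ v∈req q₂))
    len : length (l₁′ ++ r ∷ l₂′) ≤ bound (length (r ∷ req))
    len = begin
      length (l₁′ ++ r ∷ l₂′)          ≡⟨ length-++ l₁′ ⟩
      length l₁′ + suc (length l₂′)    ≡⟨ +-suc (length l₁′) _ ⟩
      suc (length l₁′ + length l₂′)    ≤⟨ s≤s (+-mono-≤ len₁ len₂) ⟩
      bound (length (r ∷ req))         ∎
      where open ≤-Reasoning

pending-persists : ∀ {S : Set} (R : S → S → Set) (Pending Goal : S → Set)
  → (∀ {x y} → R x y → Pending x → Goal x ⊎ Pending y)
  → (s : ℕ → S) → ∀ d q → (∀ j → j < d + q → R (s j) (s (suc j))) → Pending (s q)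
  → (Σ[ j ∈ ℕ ] q ≤ j × j < d + q × Goal (s j)) ⊎ Pending (s (d + q))
pending-persists R Pending Goal persists s zero    q steps pq = inj₂ pq
pending-persists R Pending Goal persists s (suc d) q steps pq
  with pending-persists R Pending Goal persists s d q (λ j j<d+q → steps j (m<n⇒m<1+n j<d+q)) pq
... | inj₁ (j , q≤j , j<d+q , g) = inj₁ (j , q≤j , m<n⇒m<1+n j<d+q , g)
... | inj₂ p with persists (steps (d + q) ≤-refl) p
...   | inj₁ g  = inj₁ (d + q , m≤n+m q d , ≤-refl , g)
...   | inj₂ p′ = inj₂ p′

module Lasso {S : Set} (v₀ : S) (vs : List S) where

  loop : S → List S → ℕ → S
  loop x xs       zero    = x
  loop x []       (suc q) = loop v₀ vs q
  loop x (y ∷ ys) (suc q) = loop y ys q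

  loop-++ : ∀ x ys z zs q → loop x (ys ++ z ∷ zs) (suc (length ys) + q) ≡ loop z zs q
  loop-++ x []       z zs q = refl
  loop-++ x (y ∷ ys) z zs q = loop-++ y ys z zs q

  loop-restart : ∀ x xs q → loop x xs (suc (length xs) + q) ≡ loop v₀ vs q
  loop-restart x []       q = refl
  loop-restart x (y ∷ ys) q = loop-restart y ys q

  loop-∈ : ∀ {L} x xs q → x ∈ L → xs ⊆ L → vs ⊆ L → v₀ ∈ L → loop x xs q ∈ L
  loop-∈ x xs       zero    x∈L _      _     _    = x∈L
  loop-∈ x []       (suc q) _   _      vs⊆L v₀∈L = loop-∈ v₀ vs q v₀∈L vs⊆L vs⊆L v₀∈L
  loop-∈ x (y ∷ ys) (suc q) _   xs⊆L   vs⊆L v₀∈L = loop-∈ y ys q (xs⊆L (here refl)) (xs⊆L ∘ there) vs⊆L v₀∈L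

  loop-visits : ∀ {y} x xs → y ∈ x ∷ xs → Σ[ r ∈ ℕ ] loop x xs r ≡ y
  loop-visits x xs       (here refl)       = 0 , refl
  loop-visits x (z ∷ zs) (there y∈zs) with loop-visits z zs y∈zs
  ... | r , e = suc r , e

  loop-steps : ∀ {R : S → S → Set} x xs → Path R x xs v₀ → Path R v₀ vs v₀
    → ∀ q → R (loop x xs q) (loop x xs (suc q))
  loop-steps x []       r       _   zero    = r
  loop-steps x (y ∷ ys) (r , _) _   zero    = r
  loop-steps x []       _       cyc (suc q) = loop-steps v₀ vs cyc cyc q
  loop-steps x (y ∷ ys) (_ , p) cyc (suc q) = loop-steps y ys p cyc q

  cycle-periodic : ∀ n r → loop v₀ vs (n * suc (length vs) + r) ≡ loop v₀ vs r
  cycle-periodic zero    r = refl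
  cycle-periodic (suc n) r = begin
    loop v₀ vs ((suc (length vs) + n * suc (length vs)) + r) ≡⟨ cong (loop v₀ vs) (+-assoc (suc (length vs)) _ r) ⟩
    loop v₀ vs (suc (length vs) + (n * suc (length vs) + r)) ≡⟨ loop-restart v₀ vs _ ⟩
    loop v₀ vs (n * suc (length vs) + r)                     ≡⟨ cycle-periodic n r ⟩
    loop v₀ vs r                                             ∎
    where open ≡-Reasoning

  lasso : S → List S → ℕ → S
  lasso s₀ u = loop s₀ (u ++ v₀ ∷ vs)

  lasso-steps : ∀ {R : S → S → Set} s₀ u → Path R s₀ u v₀ → Path R v₀ vs v₀
    → ∀ q → R (lasso s₀ u q) (lasso s₀ u (suc q))
  lasso-steps {R} s₀ u pre cyc = loop-steps s₀ (u ++ v₀ ∷ vs) (path-join R s₀ u v₀ vs v₀ pre cyc) cyc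

  lasso-cycle : ∀ s₀ u q → lasso s₀ u (suc (length u) + q) ∈ v₀ ∷ vs
  lasso-cycle s₀ u q = subst (_∈ v₀ ∷ vs) (sym (loop-++ s₀ u v₀ vs q)) (loop-∈ v₀ vs q (here refl) there there (here refl))

  lasso-recurs : ∀ s₀ u {y} → y ∈ v₀ ∷ vs → ∀ q → Σ[ k ∈ ℕ ] q ≤ k × lasso s₀ u k ≡ y
  lasso-recurs s₀ u y∈cycle q with loop-visits v₀ vs y∈cycle
  ... | r , e = suc (length u) + (q * suc (length vs) + r) , q≤k ,
                trans (loop-++ s₀ u v₀ vs _) (trans (cycle-periodic q r) e)
    where
    q≤k : q ≤ suc (length u) + (q * suc (length vs) + r)
    q≤k = ≤-trans (m≤m*n q (suc (length vs))) (≤-trans (m≤m+n _ r) (m≤n+m _ (suc (length u))))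

  lasso-fulfils : ∀ (R : S → S → Set) (Pending Goal : S → Set)
    → (∀ {x y} → R x y → Pending x → Goal x ⊎ Pending y)
    → ∀ s₀ u → Path R s₀ u v₀ → Path R v₀ vs v₀ → (Any Pending (v₀ ∷ vs) → Any Goal (v₀ ∷ vs))
    → ∀ q → Pending (lasso s₀ u q) → Σ[ k ∈ ℕ ] q ≤ k × Goal (lasso s₀ u k)
  lasso-fulfils R Pending Goal persists s₀ u pre cyc discharged q pq
    with pending-persists R Pending Goal persists (lasso s₀ u) (suc (length u)) q
           (λ j _ → lasso-steps s₀ u pre cyc j) pq
  ... | inj₁ (j , q≤j , _ , g) = j , q≤j , g
  ... | inj₂ p with find (discharged (lose (lasso-cycle s₀ u q) p))
  ...   | y , y∈cycle , g with lasso-recurs s₀ u y∈cycle q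
  ...     | k , q≤k , e = k , q≤k , subst Goal (sym e) g

reflects-true : ∀ {P : Set} {b} → Reflects P b → T b → P
reflects-true (ofʸ p) _ = p

reflects-T : ∀ {P : Set} {b} → Reflects P b → P → T b
reflects-T (ofʸ _)  _ = tt
reflects-T (ofⁿ ¬p) p = ¬p p

reflects-⇔ : ∀ {P Q : Set} {b} → P ⇔ Q → Reflects P b → Reflects Q b
reflects-⇔ P⇔Q r = fromEquivalence (Equivalence.to P⇔Q ∘ reflects-true r) (reflects-T r ∘ Equivalence.from P⇔Q)

data Until (P Q : ℕ → Set) : ℕ → Set where
  now   : ∀ {i} → Q i → Until P Q i
  later : ∀ {i} → P i → Until P Q (suc i) → Until P Q i

module _ {P Q : ℕ → Set} where

  until-unfold : ∀ {i} → Until P Q i ⇔ (Q i ⊎ (P i × Until P Q (suc i)))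
  until-unfold = mk⇔ (λ { (now q) → inj₁ q ; (later p u) → inj₂ (p , u) })
                     (λ { (inj₁ q) → now q ; (inj₂ (p , u)) → later p u })

  until-witness : ∀ {i} → Until P Q i ⇔ (Σ[ k ∈ ℕ ] i ≤ k × Q k × (∀ j → i ≤ j → j < k → P j))
  until-witness {i} = mk⇔ to (λ (k , i≤k , q , ps) → from (k ∸ i) i (subst Q (sym (m∸n+n≡m i≤k)) q)
                                                       (λ j i≤j j< → ps j i≤j (subst (j <_) (m∸n+n≡m i≤k) j<)))
    where
    to : ∀ {i} → Until P Q i → Σ[ k ∈ ℕ ] i ≤ k × Q k × (∀ j → i ≤ j → j < k → P j)
    to {i} (now q) = i , ≤-refl , q , λ j i≤j j<i → ⊥-elim (<-irrefl refl (≤-<-trans i≤j j<i))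
    to {i} (later p u) with to u
    ... | k , i<k , q , ps = k , <⇒≤ i<k , q , λ j i≤j j<k → [ (λ i<j → ps j i<j j<k) , (λ { refl → p }) ]′ (m≤n⇒m<n∨m≡n i≤j)
    from : ∀ d i → Q (d + i) → (∀ j → i ≤ j → j < d + i → P j) → Until P Q i
    from zero    i q _  = now q
    from (suc d) i q ps = later (ps i ≤-refl (s≤s (m≤n+m i d)))
      (from d (suc i) (subst Q (sym (+-suc d i)) q) (λ j i<j j< → ps j (<⇒≤ i<j) (subst (j <_) (+-suc d i) j<)))

  until-reflects : ∀ {x y b : ℕ → Bool}
    → (∀ i → Reflects (P i) (x i)) → (∀ i → Reflects (Q i) (y i))
    → (∀ i → b i ≡ y i ∨ (x i ∧ b (suc i)))
    → (∀ i → T (b i) → Σ[ k ∈ ℕ ] i ≤ k × T (y k))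
    → ∀ i → Reflects (Until P Q i) (b i)
  until-reflects {x} {y} {b} rP rQ fixpoint eventually i = fromEquivalence true⇒until until⇒true
    where
    unfold : ∀ {i} → T (b i) → T (y i) ⊎ (T (x i) × T (b (suc i)))
    unfold {i} bi with Equivalence.to T-∨ (subst T (fixpoint i) bi)
    ... | inj₁ yi  = inj₁ yi
    ... | inj₂ xbi = inj₂ (Equivalence.to T-∧ xbi)
    fold : ∀ {i} → T (y i) ⊎ (T (x i) × T (b (suc i))) → T (b i)
    fold {i} h = subst T (sym (fixpoint i)) (Equivalence.from T-∨ ([ inj₁ , (λ xb → inj₂ (Equivalence.from T-∧ xb)) ]′ h))
    reach : ∀ d i → T (b i) → T (y (d + i)) → Until P Q i
    reach zero    i _  yi = now (reflects-true (rQ i) yi)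
    reach (suc d) i bi yk with unfold bi
    ... | inj₁ yi         = now (reflects-true (rQ i) yi)
    ... | inj₂ (xi , bi′) = later (reflects-true (rP i) xi) (reach d (suc i) bi′ (subst (T ∘ y) (sym (+-suc d i)) yk))
    true⇒until : T (b i) → Until P Q i
    true⇒until bi with eventually i bi
    ... | k , i≤k , yk = reach (k ∸ i) i bi (subst (T ∘ y) (sym (m∸n+n≡m i≤k)) yk)
    until⇒true : ∀ {i} → Until P Q i → T (b i)
    until⇒true (now q)     = fold (inj₁ (reflects-T (rQ _) q))
    until⇒true (later p u) = fold (inj₂ (reflects-T (rP _) p , until⇒true u))

  until-step-reflects : ∀ {i x y b} → Reflects (P i) x → Reflects (Q i) y → Reflects (Until P Q (suc i)) b
    → Reflects (Until P Q i) (y ∨ (x ∧ b))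
  until-step-reflects rP rQ rU = reflects-⇔ (⇔.sym until-unfold) (rQ ⊎-reflects (rP ×-reflects rU))

¬-⇔ : ∀ {P Q : Set} → P ⇔ Q → (¬ P) ⇔ (¬ Q)
¬-⇔ P⇔Q = mk⇔ (λ ¬p q → ¬p (Equivalence.from P⇔Q q)) (λ ¬q p → ¬q (Equivalence.to P⇔Q p))

data Connective : Set where
  or and : Connective

apply : Connective → Bool → Bool → Bool
apply or  = _∨_
apply and = _∧_

Apply : Connective → Set → Set → Set
Apply or  = _⊎_
Apply and = _×_

apply-reflects : ∀ c {P Q : Set} {x y} → Reflects P x → Reflects Q y → Reflects (Apply c P Q) (apply c x y)
apply-reflects or  = _⊎-reflects_
apply-reflects and = _×-reflects_

data Formula (A : Set) : Set where
  atom  : (A → Bool) → Formula A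
  neg   : Formula A → Formula A
  bin   : Connective → Formula A → Formula A → Formula A
  next  : Formula A → Formula A
  until : Formula A → Formula A → Formula A

Word : Set → Set
Word A = ℕ → A

Holds : ∀ {A : Set} → Formula A → Word A → ℕ → Set
Holds (atom p)    w i = T (p (w i))
Holds (neg φ)     w i = ¬ Holds φ w i
Holds (bin c φ ψ) w i = Apply c (Holds φ w i) (Holds ψ w i)
Holds (next φ)    w i = Holds φ w (suc i)
Holds (until φ ψ) w i = Until (Holds φ w) (Holds ψ w) i

module _ {A : Set} where

  -- A label of φ guesses a truth value for each next- and until-subformula;
  -- together with the current letter it determines a claimed truth value of
  -- every subformula.
  Label : Formula A → Set
  Label (atom _)    = ⊤
  Label (neg φ)     = Label φ
  Label (bin _ φ ψ) = Label φ × Label ψ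
  Label (next φ)    = Bool × Label φ
  Label (until φ ψ) = Bool × Label φ × Label ψ

  finite-Label : ∀ φ → Finite (Label φ)
  finite-Label (atom _)    = finite-⊤
  finite-Label (neg φ)     = finite-Label φ
  finite-Label (bin _ φ ψ) = finite-× (finite-Label φ) (finite-Label ψ)
  finite-Label (next φ)    = finite-× finite-Bool (finite-Label φ)
  finite-Label (until φ ψ) = finite-× finite-Bool (finite-× (finite-Label φ) (finite-Label ψ))

  claim : ∀ φ → A → Label φ → Bool
  claim (atom p)    a _              = p a
  claim (neg φ)     a l              = not (claim φ a l)
  claim (bin c φ ψ) a (l₁ , l₂)      = apply c (claim φ a l₁) (claim ψ a l₂)
  claim (next φ)    a (b , _)        = b
  claim (until φ ψ) a (b , _ , _)    = b

  Step : ∀ φ → A → Label φ → A → Label φ → Set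
  Step (atom _)    _ _              _  _                 = ⊤
  Step (neg φ)     a l              a′ l′                = Step φ a l a′ l′
  Step (bin _ φ ψ) a (l₁ , l₂)      a′ (l₁′ , l₂′)       = Step φ a l₁ a′ l₁′ × Step ψ a l₂ a′ l₂′
  Step (next φ)    a (b , l)        a′ (_ , l′)          = b ≡ claim φ a′ l′ × Step φ a l a′ l′
  Step (until φ ψ) a (b , l₁ , l₂)  a′ (b′ , l₁′ , l₂′)  =
    b ≡ claim ψ a l₂ ∨ (claim φ a l₁ ∧ b′) × Step φ a l₁ a′ l₁′ × Step ψ a l₂ a′ l₂′

  step? : ∀ φ a l a′ l′ → Dec (Step φ a l a′ l′)
  step? (atom _)    _ _ _ _ = yes tt
  step? (neg φ)     a l a′ l′ = step? φ a l a′ l′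
  step? (bin _ φ ψ) a l a′ l′ = step? φ _ _ _ _ ×-dec step? ψ _ _ _ _
  step? (next φ)    a l a′ l′ = (proj₁ l Bool.≟ _) ×-dec step? φ _ _ _ _
  step? (until φ ψ) a l a′ l′ = (proj₁ l Bool.≟ _) ×-dec (step? φ _ _ _ _ ×-dec step? ψ _ _ _ _)

  data Obligation : Formula A → Set where
    this    : ∀ {φ ψ} → Obligation (until φ ψ)
    inNeg   : ∀ {φ} → Obligation φ → Obligation (neg φ)
    inLeft  : ∀ {c φ ψ} → Obligation φ → Obligation (bin c φ ψ)
    inRight : ∀ {c φ ψ} → Obligation ψ → Obligation (bin c φ ψ)
    inNext  : ∀ {φ} → Obligation φ → Obligation (next φ)
    inLhs   : ∀ {φ ψ} → Obligation φ → Obligation (until φ ψ)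
    inRhs   : ∀ {φ ψ} → Obligation ψ → Obligation (until φ ψ)

  obligations : ∀ φ → List (Obligation φ)
  obligations (atom _)    = []
  obligations (neg φ)     = map inNeg (obligations φ)
  obligations (bin _ φ ψ) = map inLeft (obligations φ) ++ map inRight (obligations ψ)
  obligations (next φ)    = map inNext (obligations φ)
  obligations (until φ ψ) = this ∷ map inLhs (obligations φ) ++ map inRhs (obligations ψ)

  ∈-obligations : ∀ {φ} (o : Obligation φ) → o ∈ obligations φ
  ∈-obligations this        = here refl
  ∈-obligations (inNeg o)   = ∈-map⁺ inNeg (∈-obligations o)
  ∈-obligations (inLeft o)  = ∈-++⁺ˡ (∈-map⁺ inLeft (∈-obligations o))
  ∈-obligations {bin _ φ _} (inRight o) = ∈-++⁺ʳ (map inLeft (obligations φ)) (∈-map⁺ inRight (∈-obligations o))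
  ∈-obligations (inNext o)  = ∈-map⁺ inNext (∈-obligations o)
  ∈-obligations (inLhs o)   = there (∈-++⁺ˡ (∈-map⁺ inLhs (∈-obligations o)))
  ∈-obligations {until φ _} (inRhs o) = there (∈-++⁺ʳ (map inLhs (obligations φ)) (∈-map⁺ inRhs (∈-obligations o)))

  lhs rhs : ∀ {φ} → Obligation φ → Formula A
  lhs (this {φ})  = φ
  lhs (inNeg o)   = lhs o
  lhs (inLeft o)  = lhs o
  lhs (inRight o) = lhs o
  lhs (inNext o)  = lhs o
  lhs (inLhs o)   = lhs o
  lhs (inRhs o)   = lhs o
  rhs (this {_} {ψ}) = ψ
  rhs (inNeg o)   = rhs o
  rhs (inLeft o)  = rhs o
  rhs (inRight o) = rhs o
  rhs (inNext o)  = rhs o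
  rhs (inLhs o)   = rhs o
  rhs (inRhs o)   = rhs o

  pending : ∀ {φ} → Obligation φ → Label φ → Bool
  pending this        (b , _ , _) = b
  pending (inNeg o)   l           = pending o l
  pending (inLeft o)  (l , _)     = pending o l
  pending (inRight o) (_ , l)     = pending o l
  pending (inNext o)  (_ , l)     = pending o l
  pending (inLhs o)   (_ , l , _) = pending o l
  pending (inRhs o)   (_ , _ , l) = pending o l

  goal : ∀ {φ} → Obligation φ → A → Label φ → Bool
  goal (this {_} {ψ}) a (_ , _ , l) = claim ψ a l
  goal (inNeg o)      a l           = goal o a l
  goal (inLeft o)     a (l , _)     = goal o a l
  goal (inRight o)    a (_ , l)     = goal o a l
  goal (inNext o)     a (_ , l)     = goal o a l
  goal (inLhs o)      a (_ , l , _) = goal o a l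
  goal (inRhs o)      a (_ , _ , l) = goal o a l

  pending-step : ∀ {φ} (o : Obligation φ) {a l a′ l′} → Step φ a l a′ l′
    → T (pending o l) → T (goal o a l) ⊎ T (pending o l′)
  pending-step this (fix , _) p with Equivalence.to T-∨ (subst T fix p)
  ... | inj₁ g  = inj₁ g
  ... | inj₂ xb = inj₂ (proj₂ (Equivalence.to T-∧ xb))
  pending-step (inNeg o)   st = pending-step o st
  pending-step (inLeft o)  st = pending-step o (proj₁ st)
  pending-step (inRight o) st = pending-step o (proj₂ st)
  pending-step (inNext o)  st = pending-step o (proj₂ st)
  pending-step (inLhs o)   st = pending-step o (proj₁ (proj₂ st))
  pending-step (inRhs o)   st = pending-step o (proj₂ (proj₂ st))

  Hintikka : ∀ φ → Word A → (ℕ → Label φ) → Set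
  Hintikka φ w lab = (∀ q → Step φ (w q) (lab q) (w (suc q)) (lab (suc q)))
                   × (∀ (o : Obligation φ) q → T (pending o (lab q)) → Σ[ k ∈ ℕ ] q ≤ k × T (goal o (w k) (lab k)))

  truth : ∀ φ w lab → Hintikka φ w lab → ∀ q → Reflects (Holds φ w q) (claim φ (w q) (lab q))
  truth (atom p)    w lab _ q = T-reflects (p (w q))
  truth (neg φ)     w lab (steps , fulfil) q =
    ¬-reflects (truth φ w lab (steps , (λ o → fulfil (inNeg o))) q)
  truth (bin c φ ψ) w lab (steps , fulfil) q =
    apply-reflects c (truth φ w (proj₁ ∘ lab) ((λ q → proj₁ (steps q)) , (λ o → fulfil (inLeft o))) q)
                     (truth ψ w (proj₂ ∘ lab) ((λ q → proj₂ (steps q)) , (λ o → fulfil (inRight o))) q)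
  truth (next φ)    w lab (steps , fulfil) q =
    subst (Reflects _) (sym (proj₁ (steps q))) (truth φ w (proj₂ ∘ lab) ((λ q → proj₂ (steps q)) , (λ o → fulfil (inNext o))) (suc q))
  truth (until φ ψ) w lab (steps , fulfil) =
    until-reflects (truth φ w (proj₁ ∘ proj₂ ∘ lab) ((λ q → proj₁ (proj₂ (steps q))) , (λ o → fulfil (inLhs o))))
                   (truth ψ w (proj₂ ∘ proj₂ ∘ lab) ((λ q → proj₂ (proj₂ (steps q))) , (λ o → fulfil (inRhs o))))
                   (λ q → proj₁ (steps q)) (fulfil this)

conjunction : ∀ {A : Set} → List (Formula A) → Formula A
conjunction []       = atom (λ _ → true)
conjunction (θ ∷ θs) = bin and θ (conjunction θs)

conjunction-holds : ∀ {A : Set} θs {w : Word A} {i} → Holds (conjunction θs) w i ⇔ All.All (λ θ → Holds θ w i) θs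
conjunction-holds []       = mk⇔ (λ _ → All.[]) (λ _ → tt)
conjunction-holds (θ ∷ θs) = mk⇔ (λ (h , hs) → h All.∷ Equivalence.to (conjunction-holds θs) hs)
                                 (λ { (h All.∷ hs) → h , Equivalence.from (conjunction-holds θs) hs })

module Correctness {A : Set} (w : Word A) where

  Correct : ∀ φ → ℕ → Label φ → Set
  Correct (atom _)    q _             = ⊤
  Correct (neg φ)     q l             = Correct φ q l
  Correct (bin _ φ ψ) q (l₁ , l₂)     = Correct φ q l₁ × Correct ψ q l₂
  Correct (next φ)    q (b , l)       = Reflects (Holds φ w (suc q)) b × Correct φ q l
  Correct (until φ ψ) q (b , l₁ , l₂) = Reflects (Holds (until φ ψ) w q) b × Correct φ q l₁ × Correct ψ q l₂

  correct-claim : ∀ φ {q l} → Correct φ q l → Reflects (Holds φ w q) (claim φ (w q) l)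
  correct-claim (atom p)    _          = T-reflects _
  correct-claim (neg φ)     c          = ¬-reflects (correct-claim φ c)
  correct-claim (bin k φ ψ) (c₁ , c₂)  = apply-reflects k (correct-claim φ c₁) (correct-claim ψ c₂)
  correct-claim (next φ)    (r , _)    = r
  correct-claim (until φ ψ) (r , _)    = r

  correct-step : ∀ φ {q l l′} → Correct φ q l → Correct φ (suc q) l′ → Step φ (w q) l (w (suc q)) l′
  correct-step (atom _)    _          _             = tt
  correct-step (neg φ)     c          c′            = correct-step φ c c′
  correct-step (bin _ φ ψ) (c₁ , c₂)  (c₁′ , c₂′)   = correct-step φ c₁ c₁′ , correct-step ψ c₂ c₂′
  correct-step (next φ)    (r , c)    (_ , c′)      = det r (correct-claim φ c′) , correct-step φ c c′
  correct-step (until φ ψ) (r , c₁ , c₂) (r′ , c₁′ , c₂′) =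
    det r (until-step-reflects (correct-claim φ c₁) (correct-claim ψ c₂) r′) ,
    correct-step φ c₁ c₁′ , correct-step ψ c₂ c₂′

  correct-pending : ∀ {φ} (o : Obligation φ) {q l} → Correct φ q l
    → Reflects (Holds (until (lhs o) (rhs o)) w q) (pending o l)
  correct-pending this        (r , _)     = r
  correct-pending (inNeg o)   c           = correct-pending o c
  correct-pending (inLeft o)  (c , _)     = correct-pending o c
  correct-pending (inRight o) (_ , c)     = correct-pending o c
  correct-pending (inNext o)  (_ , c)     = correct-pending o c
  correct-pending (inLhs o)   (_ , c , _) = correct-pending o c
  correct-pending (inRhs o)   (_ , _ , c) = correct-pending o c

  correct-goal : ∀ {φ} (o : Obligation φ) {q l} → Correct φ q l
    → Reflects (Holds (rhs o) w q) (goal o (w q) l)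
  correct-goal (this {_} {ψ}) (_ , _ , c) = correct-claim ψ c
  correct-goal (inNeg o)      c           = correct-goal o c
  correct-goal (inLeft o)     (c , _)     = correct-goal o c
  correct-goal (inRight o)    (_ , c)     = correct-goal o c
  correct-goal (inNext o)     (_ , c)     = correct-goal o c
  correct-goal (inLhs o)      (_ , c , _) = correct-goal o c
  correct-goal (inRhs o)      (_ , _ , c) = correct-goal o c

  correct-exists : ∀ φ q → ¬¬ Σ (Label φ) (Correct φ q)
  correct-exists (atom _)    q = pure (tt , tt)
  correct-exists (neg φ)     q = correct-exists φ q
  correct-exists (bin _ φ ψ) q =
    correct-exists φ q >>= λ (l₁ , c₁) → correct-exists ψ q >>= λ (l₂ , c₂) → pure ((l₁ , l₂) , c₁ , c₂)
  correct-exists (next φ)    q =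
    correct-exists φ q >>= λ (l , c) → ¬¬-excluded-middle >>= λ d → pure ((does d , l) , proof d , c)
  correct-exists (until φ ψ) q =
    correct-exists φ q >>= λ (l₁ , c₁) → correct-exists ψ q >>= λ (l₂ , c₂) →
    ¬¬-excluded-middle >>= λ d → pure ((does d , l₁ , l₂) , proof d , c₁ , c₂)

module Satisfiability {A : Set} (FA : Finite A) (χ : Formula A) where

  State : Set
  State = A × Label χ

  finite-State : Finite State
  finite-State = finite-× FA (finite-Label χ)

  Transition : State → State → Set
  Transition (a , l) (a′ , l′) = Step χ a l a′ l′

  Pending Discharged : Obligation χ → State → Set
  Pending    o (_ , l) = T (pending o l)
  Discharged o (a , l) = T (goal o a l)

  CycleFulfils : List State → Set
  CycleFulfils L = ∀ o → Any (Pending o) L → Any (Discharged o) L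

  Candidate : Set
  Candidate = State × List State × State × List State

  Valid : Candidate → Set
  Valid (s₀ , u , v₀ , vs) =
    T (claim χ (proj₁ s₀) (proj₂ s₀)) × Path Transition s₀ u v₀ × Path Transition v₀ vs v₀ × CycleFulfils (v₀ ∷ vs)

  valid? : ∀ c → Dec (Valid c)
  valid? (s₀ , u , v₀ , vs) =
    T? _ ×-dec path? Transition transition? s₀ u v₀ ×-dec path? Transition transition? v₀ vs v₀ ×-dec
    ∀-dec (obligations χ) ∈-obligations (λ o → Any.any? (λ s → T? _) (v₀ ∷ vs) →-dec Any.any? (λ s → T? _) (v₀ ∷ vs))
    where
    transition? : ∀ s s′ → Dec (Transition s s′)
    transition? (a , l) (a′ , l′) = step? χ a l a′ l′

  -- Soundness: the lasso of a valid candidate is a Hintikka sequence, hence a model.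
  valid⇒model : ∀ c → Valid c → Σ[ w ∈ Word A ] Holds χ w 0
  valid⇒model (s₀ , u , v₀ , vs) (c₀ , pre , cyc , fulfils) =
    proj₁ ∘ run , reflects-true (truth χ (proj₁ ∘ run) (proj₂ ∘ run) hintikka 0) c₀
    where
    open Lasso v₀ vs
    run : ℕ → State
    run = lasso s₀ u
    hintikka : Hintikka χ (proj₁ ∘ run) (proj₂ ∘ run)
    hintikka = lasso-steps s₀ u pre cyc ,
               λ o → lasso-fulfils Transition (Pending o) (Discharged o) (pending-step o) s₀ u pre cyc (fulfils o)

  open Shortening finite-State Transition using (K; bound; bound-mono; shorten)

  candidates : List Candidate
  candidates =
    cartesianProduct E (cartesianProduct (boundedLists E (bound 0))
      (cartesianProduct E (boundedLists E (bound (length (obligations χ))))))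
    where
    E : List State
    E = elements finite-State

  -- Shortening: a valid candidate can be replaced by a bounded one, keeping on
  -- the cycle one discharging state for each obligation.
  shorten-valid : ∀ c → Valid c → Σ[ c′ ∈ Candidate ] Valid c′ × c′ ∈ candidates
  shorten-valid (s₀ , u , v₀ , vs) (c₀ , pre , cyc , fulfils)
    with shorten [] s₀ u v₀ pre | witnesses (λ o s → T? _) (obligations χ) (v₀ ∷ vs)
  ... | u′ , pre′ , _ , _ , |u′| | req , |req| , req⊆cycle , discharging
    with shorten req v₀ vs v₀ cyc
  ... | vs′ , cyc′ , vs′⊆vs , keep , |vs′| =
    (s₀ , u′ , v₀ , vs′) , (c₀ , pre′ , cyc′ , fulfils′) ,
    ∈-cartesianProduct⁺ (complete finite-State s₀) (∈-cartesianProduct⁺ (∈-boundedLists finite-State _ u′ |u′|)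
      (∈-cartesianProduct⁺ (complete finite-State v₀) (∈-boundedLists finite-State _ vs′ (≤-trans |vs′| (bound-mono |req|)))))
    where
    cycle′⊆cycle : v₀ ∷ vs′ ⊆ v₀ ∷ vs
    cycle′⊆cycle (here e)  = here e
    cycle′⊆cycle (there q) = there (vs′⊆vs q)
    kept : ∀ {r} → r ∈ req → r ∈ v₀ ∷ vs′
    kept r∈req with req⊆cycle r∈req
    ... | here e      = here e
    ... | there r∈vs  = there (keep r∈req r∈vs)
    fulfils′ : CycleFulfils (v₀ ∷ vs′)
    fulfils′ o p with find (discharging (∈-obligations o) (fulfils o (Any-resp-⊆ cycle′⊆cycle p)))
    ... | r , r∈req , g = lose (kept r∈req) g

  module Extraction (w : Word A) where
    open Correctness w

    Witnessed : ℕ → ℕ → Set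
    Witnessed q m = ∀ (o : Obligation χ) → Holds (until (lhs o) (rhs o)) w q
                  → Σ[ k ∈ ℕ ] q ≤ k × k ≤ m × Holds (rhs o) w k

    witnessed-bound : ∀ q → ¬¬ Σ[ m ∈ ℕ ] q ≤ m × Witnessed q m
    witnessed-bound q =
      ¬¬-common-bound mono single (obligations χ) q >>= λ (m , q≤m , W) →
      pure (m , q≤m , λ o → W o (∈-obligations o))
      where
      P : Obligation χ → ℕ → Set
      P o m = Holds (until (lhs o) (rhs o)) w q → Σ[ k ∈ ℕ ] q ≤ k × k ≤ m × Holds (rhs o) w k
      mono : ∀ o {m m′} → m ≤ m′ → P o m → P o m′
      mono o m≤m′ p u = let (k , q≤k , k≤m , h) = p u in k , q≤k , ≤-trans k≤m m≤m′ , h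
      single : ∀ o → ¬¬ Σ ℕ (P o)
      single o = independence-of-premise 0 λ u →
        let (k , q≤k , h , _) = Equivalence.to until-witness u in k , k , q≤k , ≤-refl , h

    Window : ℕ → ℕ → Set
    Window p p′ = Σ[ m ∈ ℕ ] p ≤ m × m < p′ × Witnessed p m

    next-window : ∀ p → ¬¬ Σ ℕ (Window p)
    next-window p = witnessed-bound p >>= λ (m , p≤m , W) → pure (suc m , m , p≤m , ≤-refl , W)

    lasso-candidate : (lab : ℕ → Label χ) → ∀ {pa pb} → 0 < pa → pa < pb
      → (∀ q → q ≤ pb → Correct χ q (lab q)) → (w pa , lab pa) ≡ (w pb , lab pb) → Σ ℕ (λ m → pa ≤ m × m < pb × Witnessed pa m)
      → Holds χ w 0 → Σ Candidate Valid
    lasso-candidate lab {suc d} {pb} _ pa<pb correct closes (m , pa≤m , m<pb , W) holds =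
      (st 0 , window st 1 d , st pa , window st (suc pa) n) ,
      reflects-T (correct-claim χ (correct 0 z≤n)) holds ,
      path-window st Transition 0 d (λ j j<pa → steps j (<-trans j<pa pa<pb)) ,
      subst (Path Transition (st pa) (window st (suc pa) n)) (sym closes)
        (subst (Path Transition (st pa) (window st (suc pa) n) ∘ st) pa+1+n≡pb
          (path-window st Transition pa n (λ j j< → steps j (subst (j <_) pa+1+n≡pb j<)))) ,
      fulfils
      where
      pa n : ℕ
      pa = suc d
      n = pb ∸ suc pa
      pa+1+n≡pb : pa + suc n ≡ pb
      pa+1+n≡pb = trans (+-suc pa n) (m+[n∸m]≡n pa<pb)
      st : ℕ → State
      st q = w q , lab q
      steps : ∀ j → j < pb → Transition (st j) (st (suc j))
      steps j j<pb = correct-step χ (correct j (<⇒≤ j<pb)) (correct (suc j) j<pb)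
      in-cycle : ∀ {k} → pa ≤ k → k < pb → st k ∈ window st pa (suc n)
      in-cycle pa≤k k<pb = ∈-window⁺ st (suc n) pa≤k (subst (_ <_) (sym pa+1+n≡pb) k<pb)
      -- An obligation pending at j in the cycle is discharged before pb, or it is
      -- still pending at pb, hence at pa, where the window provides a witness.
      discharged-from : ∀ o j → pa ≤ j → j < pb → Pending o (st j) → Any (Discharged o) (window st pa (suc n))
      discharged-from o j pa≤j j<pb p
        with pending-persists Transition (Pending o) (Discharged o) (pending-step o) st (pb ∸ j) j
               (λ i i< → steps i (subst (i <_) (m∸n+n≡m (<⇒≤ j<pb)) i<)) p
      ... | inj₁ (k , j≤k , k< , g) = lose (in-cycle (≤-trans pa≤j j≤k) (subst (k <_) (m∸n+n≡m (<⇒≤ j<pb)) k<)) g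
      ... | inj₂ p′ with W o (reflects-true (correct-pending o (correct pa (<⇒≤ pa<pb))) pending-pa)
        where
        pending-pa : Pending o (st pa)
        pending-pa = subst (Pending o) (sym closes) (subst (Pending o ∘ st) (m∸n+n≡m (<⇒≤ j<pb)) p′)
      ...   | k , pa≤k , k≤m , hk =
        lose (in-cycle pa≤k (≤-<-trans k≤m m<pb)) (reflects-T (correct-goal o (correct k (<⇒≤ (≤-<-trans k≤m m<pb)))) hk)
      fulfils : CycleFulfils (st pa ∷ window st (suc pa) n)
      fulfils o p with find p
      ... | x , x∈cycle , px with ∈-window⁻ st pa (suc n) x∈cycle
      ... | j , pa≤j , j< , refl = discharged-from o j pa≤j (subst (j <_) pa+1+n≡pb j<) px

    -- Choose K + 1 successive windows and correct labels up to the last one;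
    -- two window starts carry the same state, and the stretch between them is
    -- the cycle of a valid lasso.
    model⇒valid : Holds χ w 0 → ¬¬ Σ Candidate Valid
    model⇒valid holds =
      ¬¬-chain next-window 1 K >>= λ (ps , ps₀ , windows) →
      ¬¬-choice (correct-exists χ) (ps K) >>= λ (lab , correct) →
      pure (from-windows ps ps₀ windows lab correct)
      where
      from-windows : ∀ ps → ps 0 ≡ 1 → (∀ i → i < K → Window (ps i) (ps (suc i)))
        → ∀ lab → (∀ q → q ≤ ps K → Correct χ q (lab q)) → Σ Candidate Valid
      from-windows ps ps₀ windows lab correct with pigeonhole-finite finite-State (λ i → w (ps i) , lab (ps i))
      ... | a , b , a<b , b≤K , same with windows a (<-≤-trans a<b b≤K)
      ... | m , pa≤m , m<ps[1+a] , W =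
        lasso-candidate lab 0<pa (≤-<-trans pa≤m m<pb) (λ q q≤pb → correct q (≤-trans q≤pb (mono b≤K ≤-refl)))
          same (m , pa≤m , m<pb , W) holds
        where
        mono : ∀ {i j} → i ≤ j → j ≤ K → ps i ≤ ps j
        mono = monotone-upto ps K (λ i i<K → let (_ , p≤m , m<p′ , _) = windows i i<K in <⇒≤ (≤-<-trans p≤m m<p′))
        0<pa : 0 < ps a
        0<pa = subst (_≤ ps a) ps₀ (mono z≤n (<⇒≤ (<-≤-trans a<b b≤K)))
        m<pb : m < ps b
        m<pb = <-≤-trans m<ps[1+a] (mono a<b b≤K)

  satisfiable? : Dec (Σ[ w ∈ Word A ] Holds χ w 0)
  satisfiable? with Any.any? valid? candidates
  ... | yes v = let (c , _ , vc) = find v in yes (valid⇒model c vc)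
  ... | no ¬v = no λ (w , holds) → Extraction.model⇒valid w holds λ (c , vc) →
                  let (c′ , vc′ , c′∈) = shorten-valid c vc in ¬v (lose c′∈ vc′)

module HyperLTL (nI nO : ℕ) where

  Tr : Set
  Tr = Trace nI nO

  Sem : ∀ {N} → QF nI nO N → (Fin N → Tr) → ℕ → Set
  Sem = ⟦_⟧ nI nO

  -- N traces read in lockstep form a word over N-tuples of letters.
  Tuple : ℕ → Set
  Tuple N = Vec (Letter nI nO) N

  finite-Tuple : ∀ N → Finite (Tuple N)
  finite-Tuple = finite-Vec (finite-× (finite-Vec finite-Bool nI) (finite-Vec finite-Bool nO))

  Represents : ∀ {N} → Word (Tuple N) → (Fin N → Tr) → Set
  Represents w Π = ∀ π i → Vec.lookup (w i) π ≡ Π π i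

  zip-traces : ∀ {N} → (Fin N → Tr) → Word (Tuple N)
  zip-traces Π i = Vec.tabulate (λ π → Π π i)

  zip-represents : ∀ {N} (Π : Fin N → Tr) → Represents (zip-traces Π) Π
  zip-represents Π π i = Vec.lookup∘tabulate (λ π → Π π i) π

  translate : ∀ {N} → QF nI nO N → Formula (Tuple N)
  translate (atom (inj₁ x) π) = atom (λ v → Vec.lookup (proj₁ (Vec.lookup v π)) x)
  translate (atom (inj₂ y) π) = atom (λ v → Vec.lookup (proj₂ (Vec.lookup v π)) y)
  translate (¬' ψ)            = neg (translate ψ)
  translate (ψ ∨' χ)          = bin or (translate ψ) (translate χ)
  translate (X' ψ)            = next (translate ψ)
  translate (ψ U' χ)          = until (translate ψ) (translate χ)

  translate-correct : ∀ {N} {w} {Π : Fin N → Tr} → Represents w Π → ∀ ψ i → Holds (translate ψ) w i ⇔ Sem ψ Π i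
  translate-correct rep (atom (inj₁ x) π) i rewrite rep π i = T-≡
  translate-correct rep (atom (inj₂ y) π) i rewrite rep π i = T-≡
  translate-correct rep (¬' ψ)            i = ¬-⇔ (translate-correct rep ψ i)
  translate-correct rep (ψ ∨' χ)          i = translate-correct rep ψ i ⊎-⇔ translate-correct rep χ i
  translate-correct rep (X' ψ)            i = translate-correct rep ψ (suc i)
  translate-correct {N} {w} {Π} rep (ψ U' χ) i = ⇔.trans until-witness (mk⇔
    (λ (k , i≤k , h , hs) → k , i≤k , Equivalence.to (IH χ k) h , λ j i≤j j<k → Equivalence.to (IH ψ j) (hs j i≤j j<k))
    (λ (k , i≤k , h , hs) → k , i≤k , Equivalence.from (IH χ k) h , λ j i≤j j<k → Equivalence.from (IH ψ j) (hs j i≤j j<k)))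
    where
    IH : ∀ (θ : QF nI nO N) i → Holds (translate θ) w i ⇔ Sem θ Π i
    IH = translate-correct rep

  ConsistentPair : ∀ {N} → (Fin N → Tr) → Fin N → Fin N → Set
  ConsistentPair Π a b = ∀ i → (∀ j → j ≤ i → proj₁ (Π a j) ≡ proj₁ (Π b j)) → proj₂ (Π a i) ≡ proj₂ (Π b i)

  Consistent : ∀ {N} → (Fin N → Tr) → Set
  Consistent Π = ∀ a b → ConsistentPair Π a b

  _≟ᵛ_ : ∀ {n} → DecidableEquality (Vec Bool n)
  _≟ᵛ_ = Vec.≡-dec Bool._≟_

  sameInputs sameOutputs : ∀ {N} → Fin N → Fin N → Tuple N → Bool
  sameInputs  a b v = isYes (proj₁ (Vec.lookup v a) ≟ᵛ proj₁ (Vec.lookup v b))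
  sameOutputs a b v = isYes (proj₂ (Vec.lookup v a) ≟ᵛ proj₂ (Vec.lookup v b))

  consistent-pair : ∀ {N} → Fin N → Fin N → Formula (Tuple N)
  consistent-pair a b = neg (until (atom (sameInputs a b)) (bin and (atom (sameInputs a b)) (neg (atom (sameOutputs a b)))))

  consistent-pair-correct : ∀ {N} {w} {Π : Fin N → Tr} → Represents w Π → ∀ a b
    → Holds (consistent-pair a b) w 0 ⇔ ConsistentPair Π a b
  consistent-pair-correct {w = w} {Π} rep a b = mk⇔ to from
    where
    same-inputs : ∀ j → T (sameInputs a b (w j)) ⇔ (proj₁ (Π a j) ≡ proj₁ (Π b j))
    same-inputs j rewrite rep a j | rep b j = mk⇔ toWitness fromWitness
    same-outputs : ∀ j → T (sameOutputs a b (w j)) ⇔ (proj₂ (Π a j) ≡ proj₂ (Π b j))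
    same-outputs j rewrite rep a j | rep b j = mk⇔ toWitness fromWitness
    to : Holds (consistent-pair a b) w 0 → ConsistentPair Π a b
    to ¬violation i inputs with proj₂ (Π a i) ≟ᵛ proj₂ (Π b i)
    ... | yes e  = e
    ... | no ¬e  = ⊥-elim (¬violation (Equivalence.from until-witness
      (i , z≤n , (Equivalence.from (same-inputs i) (inputs i ≤-refl) , ¬e ∘ Equivalence.to (same-outputs i)) ,
       λ j _ j<i → Equivalence.from (same-inputs j) (inputs j (<⇒≤ j<i)))))
    from : ConsistentPair Π a b → Holds (consistent-pair a b) w 0
    from consistent violation with Equivalence.to until-witness violation
    ... | k , _ , (inputs-k , ¬outputs-k) , before = ¬outputs-k (Equivalence.from (same-outputs k) (consistent k inputs))
      where
      inputs : ∀ j → j ≤ k → proj₁ (Π a j) ≡ proj₁ (Π b j)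
      inputs j j≤k with m≤n⇒m<n∨m≡n j≤k
      ... | inj₁ j<k  = Equivalence.to (same-inputs j) (before j z≤n j<k)
      ... | inj₂ refl = Equivalence.to (same-inputs j) inputs-k

  consistency : ∀ N → Formula (Tuple N)
  consistency N = conjunction (map (uncurry consistent-pair) (cartesianProduct (allFin N) (allFin N)))

  consistency-correct : ∀ {N} {w} {Π : Fin N → Tr} → Represents w Π → Holds (consistency N) w 0 ⇔ Consistent Π
  consistency-correct {N} {w} {Π} rep = mk⇔ to from
    where
    pairs : List (Fin N × Fin N)
    pairs = cartesianProduct (allFin N) (allFin N)
    holds-pairs : Holds (consistency N) w 0 ⇔ All.All (λ (a , b) → Holds (consistent-pair a b) w 0) pairs
    holds-pairs = ⇔.trans (conjunction-holds (map (uncurry consistent-pair) pairs)) (mk⇔ All.map⁻ All.map⁺)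
    to : Holds (consistency N) w 0 → Consistent Π
    to h a b = Equivalence.to (consistent-pair-correct {w = w} rep a b)
                 (All.lookup (Equivalence.to holds-pairs h) (∈-cartesianProduct⁺ (∈-allFin a) (∈-allFin b)))
    from : Consistent Π → Holds (consistency N) w 0
    from c = Equivalence.from holds-pairs (All.tabulate (λ {(a , b)} _ → Equivalence.from (consistent-pair-correct {w = w} rep a b) (c a b)))

  history : Tr → (m : ℕ) → Vec (Subset nI) (suc m)
  history t m = Vec.tabulate (λ (j : Fin (suc m)) → proj₁ (t (toℕ j)))

  history-agrees : ∀ t t′ m → history t m ≡ history t′ m → ∀ j → j ≤ m → proj₁ (t j) ≡ proj₁ (t′ j)
  history-agrees t t′ m same j j≤m = begin
    proj₁ (t j)                                ≡⟨ cong (proj₁ ∘ t) (sym (toℕ-fromℕ< (s≤s j≤m))) ⟩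
    proj₁ (t (toℕ (fromℕ< (s≤s j≤m))))          ≡⟨ sym (Vec.lookup∘tabulate (λ k → proj₁ (t (toℕ k))) (fromℕ< (s≤s j≤m))) ⟩
    Vec.lookup (history t m) (fromℕ< (s≤s j≤m))  ≡⟨ cong (λ h → Vec.lookup h (fromℕ< (s≤s j≤m))) same ⟩
    Vec.lookup (history t′ m) (fromℕ< (s≤s j≤m)) ≡⟨ Vec.lookup∘tabulate (λ k → proj₁ (t′ (toℕ k))) (fromℕ< (s≤s j≤m)) ⟩
    proj₁ (t′ (toℕ (fromℕ< (s≤s j≤m))))         ≡⟨ cong (proj₁ ∘ t′) (toℕ-fromℕ< (s≤s j≤m)) ⟩
    proj₁ (t′ j)                               ∎
    where open ≡-Reasoning

  _≟ʰ_ : ∀ {m} → DecidableEquality (Vec (Subset nI) m)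
  _≟ʰ_ = Vec.≡-dec _≟ᵛ_

  strategy : ∀ {N} → (Fin N → Tr) → Strategy nI nO
  strategy Π m h with Fin.any? (λ a → history (Π a) m ≟ʰ h)
  ... | yes (a , _) = proj₂ (Π a m)
  ... | no _        = Vec.replicate nO false

  strategy-generates : ∀ {N} (Π : Fin N → Tr) → Consistent Π → ∀ b → Generated nI nO (strategy Π) (Π b)
  strategy-generates Π consistent b i with Fin.any? (λ a → history (Π a) i ≟ʰ history (Π b) i)
  ... | yes (a , same) = consistent b a i (history-agrees (Π b) (Π a) i (sym same))
  ... | no none        = ⊥-elim (none (b , refl))

  generated-consistent : ∀ {N} f (Π : Fin N → Tr) → (∀ a → Generated nI nO f (Π a)) → Consistent Π
  generated-consistent f Π generated a b i inputs =
    trans (generated a i) (trans (cong (f i) (Vec.tabulate-cong (λ j → inputs (toℕ j) (≤-pred (toℕ<n j))))) (sym (generated b i)))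

  arity : ∀ {n} {φ : Hyper nI nO n} → Existential nI nO φ → ℕ
  arity (body {n} _) = n
  arity (∃' e)       = arity e

  matrix : ∀ {n} {φ : Hyper nI nO n} (e : Existential nI nO φ) → QF nI nO (arity e)
  matrix (body ψ) = ψ
  matrix (∃' e)   = matrix e

  -- The free variables of φ are the last entries of an assignment to all of them.
  outer : ∀ {n} {φ : Hyper nI nO n} (e : Existential nI nO φ) → (Fin (arity e) → Tr) → Fin n → Tr
  outer (body _) Π = Π
  outer (∃' e)   Π = λ π → outer e Π (Fin.suc π)

  outer-in : ∀ (T′ : Tr → Set) {n} {φ : Hyper nI nO n} (e : Existential nI nO φ) (Π′ : Fin (arity e) → Tr)
    → (∀ π → T′ (Π′ π)) → ∀ π → T′ (outer e Π′ π)
  outer-in T′ (body _) Π′ inT π = inT π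
  outer-in T′ (∃' e)   Π′ inT π = outer-in T′ e Π′ inT (Fin.suc π)

  sat⇒assignment : ∀ (T′ : Tr → Set) {n} {φ : Hyper nI nO n} (e : Existential nI nO φ) (Π : Fin n → Tr)
    → (∀ π → T′ (Π π)) → Sat nI nO T′ Π φ → Σ[ Π′ ∈ (Fin (arity e) → Tr) ] (∀ π → T′ (Π′ π)) × Sem (matrix e) Π′ 0
  sat⇒assignment T′ (body ψ) Π inT sat = Π , inT , sat
  sat⇒assignment T′ (∃' e)   Π inT (t , t∈T , sat) =
    sat⇒assignment T′ e (t Functional.∷ Π) (λ { Fin.zero → t∈T ; (Fin.suc π) → inT π }) sat

  assignment⇒sat : ∀ (T′ : Tr → Set) {n} {φ : Hyper nI nO n} (e : Existential nI nO φ) (Π′ : Fin (arity e) → Tr) (Π : Fin n → Tr)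
    → (∀ π → T′ (Π′ π)) → (∀ π i → outer e Π′ π i ≡ Π π i) → Sem (matrix e) Π′ 0 → Sat nI nO T′ Π φ
  -- In the body case Π′ and Π agree pointwise; both are represented by the
  -- same word, so the translation transfers the body from one to the other.
  assignment⇒sat T′ (body ψ) Π′ Π _ extends holds =
    Equivalence.to (translate-correct {w = zip-traces Π′} (λ π i → trans (zip-represents Π′ π i) (extends π i)) ψ 0)
      (Equivalence.from (translate-correct (zip-represents Π′) ψ 0) holds)
  assignment⇒sat T′ (∃' e) Π′ Π inT extends holds =
    outer e Π′ Fin.zero , outer-in T′ e Π′ inT Fin.zero ,
    assignment⇒sat T′ e Π′ (outer e Π′ Fin.zero Functional.∷ Π) inT (λ { Fin.zero i → refl ; (Fin.suc π) i → extends π i }) holds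

  realizable⇔consistent : ∀ {φ : Hyper nI nO 0} (e : Existential nI nO φ)
    → Realizable nI nO φ ⇔ (Σ[ Π ∈ (Fin (arity e) → Tr) ] Consistent Π × Sem (matrix e) Π 0)
  realizable⇔consistent e = mk⇔
    (λ (f , sat) → let (Π , generated , holds) = sat⇒assignment (Generated nI nO f) e (λ ()) (λ ()) sat
                   in Π , generated-consistent f Π generated , holds)
    (λ (Π , consistent , holds) → strategy Π ,
       assignment⇒sat (Generated nI nO (strategy Π)) e Π (λ ()) (strategy-generates Π consistent) (λ ()) holds)

  consistent⇔satisfiable : ∀ {N} (ψ : QF nI nO N)
    → (Σ[ Π ∈ (Fin N → Tr) ] Consistent Π × Sem ψ Π 0) ⇔ (Σ[ w ∈ Word (Tuple N) ] Holds (bin and (consistency N) (translate ψ)) w 0)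
  consistent⇔satisfiable ψ = mk⇔
    (λ (Π , consistent , holds) → zip-traces Π ,
       Equivalence.from (consistency-correct (zip-represents Π)) consistent ,
       Equivalence.from (translate-correct (zip-represents Π) ψ 0) holds)
    (λ (w , consistent , holds) → (λ π i → Vec.lookup (w i) π) ,
       Equivalence.to (consistency-correct {w = w} (λ _ _ → refl)) consistent ,
       Equivalence.to (translate-correct {w = w} (λ _ _ → refl) ψ 0) holds)

mainTheorem2 : (ni no : ℕ) (φ : Hyper ni no 0) → Existential ni no φ
    → Dec (Realizable ni no φ)
mainTheorem2 nI nO φ e =
  Dec.map (⇔.sym (⇔.trans (realizable⇔consistent e) (consistent⇔satisfiable (matrix e))))
    (Satisfiability.satisfiable? (finite-Tuple (arity e)) (bin and (consistency (arity e)) (translate (matrix e))))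
  where open HyperLTL nI nO
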